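{- For every positive integer $N$ and every pair of indices $\boldsymbol{k}=(k_1,\dots,k_r)$, $\boldsymbol{l}=(l_1,\dots,l_r)$ of the same depth $r$, \[ \zeta_N\!\left(\genfrac{}{}{0pt}{}{\boldsymbol{l}}{\boldsymbol{k}}\right)=\zeta^{\flat}_N\!\left(\genfrac{}{}{0pt}{}{\boldsymbol{l}}{\boldsymbol{k}}\right). \]
   Context: An index is a tuple of positive integers. $[r]=\{1,\dots,r\}$. Define \[ \zeta_N\!\left(\genfrac{}{}{0pt}{}{\boldsymbol{l}}{\boldsymbol{k}}\right)=\sum_{\substack{0<m_{j,1}\le\cdots\le m_{j,l_j}<N\ (j\in[r])\\ m_{j,l_j}<m_{j+1,1}\ (j\in[r-1])}}\ \prod_{j\in[r]}\frac{1}{(N-m_{j,1})\cdots(N-m_{j,l_j-1})\,m_{j,l_j}^{k_j}} \] (for $l_j=1$ the factor $(N-m_{j,1})\cdots(N-m_{j,l_j-1})$ is empty), and \[ \zeta^{\flat}_N\!\left(\genfrac{}{}{0pt}{}{\boldsymbol{l}}{\boldsymbol{k}}\right)=\sum_{\substack{0<n_{i,1}\le\cdots\le n_{i,k_i}<N\ (i\in[r])\\ n_{i,k_i}<n_{i+1,1}\ (i\in[r-1])}}\ \prod_{i\in[r]}\frac{1}{(N-n_{i,1})^{l_i}\,n_{i,2}\cdots n_{i,k_i}}. \] -}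

module Defs where

open import Data.Nat using (ℕ; zero; suc; _∸_; _^_; _<ᵇ_; _≤ᵇ_)
open import Data.Integer using (+_)
open import Data.Rational using (ℚ; 0ℚ; 1ℚ; _+_; _*_; _/_)
open import Data.List using (List; []; _∷_; map; concatMap; foldr; upTo; filterᵇ)
open import Data.Bool using (Bool; true; false; _∧_)

-- 1/n as a rational; inv 0 = 0 is a junk value that never occurs below
-- (all denominators are N - m or m with 0 < m < N).
inv : ℕ → ℚ
inv zero = 0ℚ
inv (suc n) = + 1 / suc n

sumℚ : List ℚ → ℚ
sumℚ = foldr _+_ 0ℚ

prodℚ : List ℚ → ℚ
prodℚ = foldr _*_ 1ℚ

range : ℕ → List ℕ
range N = map suc (upTo (N ∸ 1))

tuples : ℕ → ℕ → List (List ℕ)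
tuples N zero = [] ∷ []
tuples N (suc n) = concatMap (λ x → map (x ∷_) (tuples N n)) (range N)

configs : ℕ → List ℕ → List (List (List ℕ))
configs N [] = [] ∷ []
configs N (l ∷ ls) = concatMap (λ b → map (b ∷_) (configs N ls)) (tuples N l)

weakInc : List ℕ → Bool
weakInc [] = true
weakInc (x ∷ []) = true
weakInc (x ∷ y ∷ xs) = (x ≤ᵇ y) ∧ weakInc (y ∷ xs)

sep : List ℕ → List ℕ → Bool
sep (x ∷ []) (y ∷ _) = x <ᵇ y
sep (x ∷ x' ∷ xs) c = sep (x' ∷ xs) c
sep _ _ = true   -- only for empty blocks, which never occur (indices are positive)

admissible : List (List ℕ) → Bool
admissible [] = true
admissible (b ∷ []) = weakInc b
admissible (b ∷ c ∷ bs) = weakInc b ∧ sep b c ∧ admissible (c ∷ bs)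

zBlock : ℕ → ℕ → List ℕ → ℚ
zBlock N k [] = 1ℚ
zBlock N k (m ∷ []) = inv (m ^ k)
zBlock N k (m ∷ m' ∷ ms) = inv (N ∸ m) * zBlock N k (m' ∷ ms)

zWeight : ℕ → List ℕ → List (List ℕ) → ℚ
zWeight N (k ∷ ks) (b ∷ bs) = zBlock N k b * zWeight N ks bs
zWeight N _ _ = 1ℚ

zetaN : ℕ → List ℕ → List ℕ → ℚ
zetaN N ls ks = sumℚ (map (zWeight N ks) (filterᵇ admissible (configs N ls)))

fBlock : ℕ → ℕ → List ℕ → ℚ
fBlock N l [] = 1ℚ
fBlock N l (n ∷ ns) = inv ((N ∸ n) ^ l) * prodℚ (map inv ns)

fWeight : ℕ → List ℕ → List (List ℕ) → ℚ
fWeight N (l ∷ ls) (b ∷ bs) = fBlock N l b * fWeight N ls bs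
fWeight N _ _ = 1ℚ

-- zeta^flat_N (l over k); arguments: N, l, k  (blocks have lengths k_i)
zetaFlatN : ℕ → List ℕ → List ℕ → ℚ
zetaFlatN N ls ks = sumℚ (map (fWeight N ls) (filterᵇ admissible (configs N ks)))

module Submission where

-- Both sides are iterated sums over 1 ≤ m < N built from two kinds of letters, L (a factor
-- 1/(N − m)) and K (a factor 1/m): the index (l over k) is the word L^l₁ K^k₁ ⋯ L^lᵣ K^kᵣ, and
-- each side reads a pair of consecutive letters as a linear operator on functions of m, the two
-- readings differing in where the sums and factors sit.  An explicit matrix, the connector
-- C(m, n) = binom(n − 1, m − 1) / (m · binom(N − 1, m)), together with its twist (n − m) C(m, n),
-- intertwines the two readings pair by pair; at the ends of the word it satisfies
-- (1/m) · 1 = C 1 and ∑ₘ (C g)(m) = ∑ₙ g(n)/(N − n).  Pushing the connector through the word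
-- from the last letter to the first therefore turns one side into the other.  Each intertwining
-- relation is a row or column sum of C, i.e. a hockey-stick or telescoping identity for falling
-- factorials.

open import Defs
open import Data.Nat using (ℕ; _≤_)
open import Data.Vec using (Vec; toList)
open import Data.Vec.Relation.Unary.All using (All)
open import Relation.Binary.PropositionalEquality using (_≡_)

open import Algebra.Bundles using (CommutativeSemiring; CommutativeRing)
open import Data.Bool using (Bool; true; false; _∧_)
open import Data.Bool.Properties using (∧-identityʳ)
open import Data.Fin using (toℕ)
open import Data.Fin.Properties using (toℕ<n; toℕ-inject₁; toℕ-fromℕ)
import Data.Integer as ℤ
import Data.Integer.Properties as ℤ
open import Data.List using (List; []; _∷_; map; concatMap; filterᵇ; _++_; applyUpTo; upTo; replicate)
open import Data.List.Properties using (map-++; map-∘; map-cong; map-applyUpTo)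
open import Data.Nat as ℕ using (zero; suc; _∸_; _^_; _!; _<_; _<ᵇ_; _≤ᵇ_; z≤n; s≤s; NonZero; >-nonZero)
import Data.Nat.Properties as ℕₚ
open import Data.Nat.Combinatorics.Base using (_P′_)
open import Data.Nat.Combinatorics.Specification using (nP′k≡n[n∸1P′k∸1])
open import Data.Nat.GeneralisedArithmetic using (fold)
open import Data.Nat.Tactic.RingSolver using (solve-∀)
open import Data.Rational using (ℚ; 1ℚ; fromℚᵘ)
import Data.Rational.Properties as ℚₚ
open import Data.Rational.Solver using (module +-*-Solver)
open import Data.Rational.Unnormalised as ℚᵘ using (mkℚᵘ; *≡*)
import Data.Rational.Unnormalised.Properties as ℚᵘ
open import Data.Vec using ([]; _∷_)
open import Data.Vec.Relation.Unary.All using ([]; _∷_)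
import Relation.Binary.PropositionalEquality as ≡
open import Relation.Nullary using (Dec; yes; no)
open import Algebra.Properties.CommutativeSemigroup
  (CommutativeRing.*-commutativeSemigroup ℚₚ.+-*-commutativeRing)
  using (interchange; x∙yz≈y∙xz; x∙yz≈yx∙z; xy∙z≈xz∙y)

m<ᵇ1+n≡m≤ᵇn : ∀ m n → (m <ᵇ suc n) ≡ (m ≤ᵇ n)
m<ᵇ1+n≡m≤ᵇn zero    n = ≡.refl
m<ᵇ1+n≡m≤ᵇn (suc m) n = ≡.refl

module RangeSum {c ℓ} (R : CommutativeSemiring c ℓ) where

  open CommutativeSemiring R
  open import Algebra.Properties.Semiring.Sum semiring
  open import Relation.Binary.Reasoning.Setoid setoid

  σ : (ℕ → Carrier) → ℕ → Carrier
  σ f n = ∑[ i < n ] f (toℕ i)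

  𝟙 : Bool → Carrier
  𝟙 true  = 1#
  𝟙 false = 0#

  𝟙-∧ : ∀ x y → 𝟙 (x ∧ y) ≈ 𝟙 x * 𝟙 y
  𝟙-∧ true  y = sym (*-identityˡ (𝟙 y))
  𝟙-∧ false y = sym (zeroˡ (𝟙 y))

  σ-cong : ∀ {f g} n → (∀ s → s < n → f s ≈ g s) → σ f n ≈ σ g n
  σ-cong n f≈g = sum-cong-≋ {n} (λ i → f≈g (toℕ i) (toℕ<n i))

  σ-vanish : ∀ {f} n → (∀ s → s < n → f s ≈ 0#) → σ f n ≈ 0#
  σ-vanish n f≈0 = trans (σ-cong n f≈0) (sum-replicate-zero n)

  σ-suc : ∀ f n → σ f (suc n) ≈ σ f n + f n
  σ-suc f n = trans (sum-init-last {n} (λ i → f (toℕ i))) (reflexive (≡.cong₂ _+_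
    (sum-cong-≗ {n} (λ i → ≡.cong f (toℕ-inject₁ i))) (≡.cong f (toℕ-fromℕ n))))

  *-distribˡ-σ : ∀ x f n → x * σ f n ≈ σ (λ s → x * f s) n
  *-distribˡ-σ x f n = *-distribˡ-sum {n} x (λ i → f (toℕ i))

  *-distribʳ-σ : ∀ x f n → σ f n * x ≈ σ (λ s → f s * x) n
  *-distribʳ-σ x f n = *-distribʳ-sum {n} x (λ i → f (toℕ i))

  σ-comm : ∀ (f : ℕ → ℕ → Carrier) m n →
           σ (λ t → σ (f t) n) m ≈ σ (λ s → σ (λ t → f t s) m) n
  σ-comm f m n = ∑-comm {m} {n} (λ i j → f (toℕ i) (toℕ j))

  σ-truncate : ∀ f {m n} → m ≤ n → σ (λ s → f s * 𝟙 (s <ᵇ m)) n ≈ σ f m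
  σ-truncate f {zero}  {n}     _         = σ-vanish n (λ s _ → zeroʳ (f s))
  σ-truncate f {suc m} {suc n} (s≤s m≤n) =
    +-cong (*-identityʳ (f 0)) (σ-truncate (λ s → f (suc s)) m≤n)

  σ-from : ∀ f i d → σ (λ t → 𝟙 (i ≤ᵇ t) * f t) (i ℕ.+ d) ≈ σ (λ e → f (i ℕ.+ e)) d
  σ-from f zero    d = σ-cong d (λ s _ → *-identityˡ (f s))
  σ-from f (suc i) d = begin
    0# * f 0 + σ (λ t → 𝟙 (i <ᵇ suc t) * f (suc t)) (i ℕ.+ d)
      ≈⟨ +-cong (zeroˡ (f 0)) (σ-cong (i ℕ.+ d) (λ t _ →
           reflexive (≡.cong (λ b → 𝟙 b * f (suc t)) (m<ᵇ1+n≡m≤ᵇn i t)))) ⟩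
    0# + σ (λ t → 𝟙 (i ≤ᵇ t) * f (suc t)) (i ℕ.+ d)
      ≈⟨ trans (+-identityˡ _) (σ-from (λ t → f (suc t)) i d) ⟩
    σ (λ e → f (suc i ℕ.+ e)) d ∎

  σ-telescope : ∀ (g y : ℕ → Carrier) n →
                (∀ s → s < n → g s + y (suc s) ≈ y s) → σ g n + y n ≈ y 0
  σ-telescope g y zero    _    = +-identityˡ (y 0)
  σ-telescope g y (suc n) step = begin
    (g 0 + σ (λ s → g (suc s)) n) + y (suc n)
      ≈⟨ +-assoc _ _ _ ⟩
    g 0 + (σ (λ s → g (suc s)) n + y (suc n))
      ≈⟨ +-congˡ (σ-telescope (λ s → g (suc s)) (λ s → y (suc s)) n (λ s s<n → step (suc s) (s≤s s<n))) ⟩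
    g 0 + y 1
      ≈⟨ step 0 (s≤s z≤n) ⟩
    y 0 ∎

  σ-kernel-assoc : ∀ (c : ℕ → Carrier) (k : ℕ → ℕ → Carrier) (g : ℕ → Carrier) m n →
                   σ (λ t → c t * σ (λ s → k t s * g s) n) m ≈ σ (λ s → σ (λ t → c t * k t s) m * g s) n
  σ-kernel-assoc c k g m n = begin
    σ (λ t → c t * σ (λ s → k t s * g s) n) m
      ≈⟨ σ-cong m (λ t _ → *-distribˡ-σ (c t) (λ s → k t s * g s) n) ⟩
    σ (λ t → σ (λ s → c t * (k t s * g s)) n) m
      ≈⟨ σ-comm (λ t s → c t * (k t s * g s)) m n ⟩
    σ (λ s → σ (λ t → c t * (k t s * g s)) m) n
      ≈⟨ σ-cong n (λ s _ → σ-cong m (λ t _ → sym (*-assoc (c t) (k t s) (g s)))) ⟩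
    σ (λ s → σ (λ t → c t * k t s * g s) m) n
      ≈⟨ σ-cong n (λ s _ → sym (*-distribʳ-σ (g s) (λ t → c t * k t s) m)) ⟩
    σ (λ s → σ (λ t → c t * k t s) m * g s) n ∎

open ≡ using (refl; sym; trans; cong; cong₂; module ≡-Reasoning)

module ℕΣ = RangeSum ℕₚ.+-*-commutativeSemiring
module ℚΣ = RangeSum (CommutativeRing.commutativeSemiring ℚₚ.+-*-commutativeRing)

module _ where

  open import Data.Nat using (_+_; _*_)
  open ℕₚ
  open ℕΣ

  P′-vanish : ∀ {n k} → n < k → n P′ k ≡ 0
  P′-vanish {n} {suc k} (s≤s n≤k) = cong (_* (n P′ k)) (m≤n⇒m∸n≡0 n≤k)

  P′-suc : ∀ n k → suc n P′ suc k ≡ suc n * (n P′ k)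
  P′-suc n k = nP′k≡n[n∸1P′k∸1] (suc n) (suc k)

  P′-pascal : ∀ n k → n P′ suc k + suc k * (n P′ k) ≡ suc n P′ suc k
  P′-pascal n k with k ≤? n
  ... | yes k≤n = begin
    (n ∸ k) * (n P′ k) + suc k * (n P′ k) ≡⟨ *-distribʳ-+ (n P′ k) (n ∸ k) (suc k) ⟨
    (n ∸ k + suc k) * (n P′ k)            ≡⟨ cong (_* (n P′ k)) n∸k+1+k≡1+n ⟩
    suc n * (n P′ k)                      ≡⟨ P′-suc n k ⟨
    suc n P′ suc k                        ∎
    where
    open ≡-Reasoning
    n∸k+1+k≡1+n : n ∸ k + suc k ≡ suc n
    n∸k+1+k≡1+n = trans (+-suc (n ∸ k) k) (cong suc (m∸n+n≡m k≤n))
  ... | no k≰n = begin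
    n P′ suc k + suc k * (n P′ k) ≡⟨ cong₂ (λ x y → x + suc k * y) (P′-vanish n<1+k) (P′-vanish n<k) ⟩
    0 + suc k * 0                 ≡⟨ *-zeroʳ (suc k) ⟩
    0                             ≡⟨ P′-vanish (s≤s n<k) ⟨
    suc n P′ suc k                ∎
    where
    open ≡-Reasoning
    n<k = ≰⇒> k≰n
    n<1+k = ≤-trans n<k (n≤1+n k)

  hockey-stick : ∀ k n → suc k * σ (_P′ k) n ≡ n P′ suc k
  hockey-stick k zero    = trans (*-zeroʳ (suc k)) (sym (P′-vanish {k = suc k} (s≤s z≤n)))
  hockey-stick k (suc n) = begin
    suc k * σ (_P′ k) (suc n)              ≡⟨ cong (suc k *_) (σ-suc (_P′ k) n) ⟩
    suc k * (σ (_P′ k) n + n P′ k)         ≡⟨ *-distribˡ-+ (suc k) _ (n P′ k) ⟩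
    suc k * σ (_P′ k) n + suc k * (n P′ k) ≡⟨ cong (_+ suc k * (n P′ k)) (hockey-stick k n) ⟩
    n P′ suc k + suc k * (n P′ k)          ≡⟨ P′-pascal n k ⟩
    suc n P′ suc k                         ∎
    where open ≡-Reasoning

  P′*!≡! : ∀ {n k} → k ≤ n → (n P′ k) * (n ∸ k) ! ≡ n !
  P′*!≡! {n}     {zero}  _         = *-identityˡ (n !)
  P′*!≡! {suc n} {suc k} (s≤s k≤n) = begin
    (suc n P′ suc k) * (n ∸ k) !   ≡⟨ cong (_* (n ∸ k) !) (P′-suc n k) ⟩
    suc n * (n P′ k) * (n ∸ k) !   ≡⟨ *-assoc (suc n) (n P′ k) ((n ∸ k) !) ⟩
    suc n * ((n P′ k) * (n ∸ k) !) ≡⟨ cong (suc n *_) (P′*!≡! k≤n) ⟩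
    suc n !                        ∎
    where open ≡-Reasoning

  ∸*!≡∸! : ∀ {m n} → n < m → (m ∸ n) * (m ∸ suc n) ! ≡ (m ∸ n) !
  ∸*!≡∸! {suc m} {zero}  _         = refl
  ∸*!≡∸! {suc m} {suc n} (s≤s n<m) = ∸*!≡∸! n<m

  m∸n+n∸o≡m∸o : ∀ {m n o} → o ≤ n → n ≤ m → (m ∸ n) + (n ∸ o) ≡ m ∸ o
  m∸n+n∸o≡m∸o {m} {n} {o} o≤n n≤m =
    sym (trans (cong (_∸ o) (sym (m∸n+n≡m n≤m))) (+-∸-assoc (m ∸ n) o≤n))

  -- Numerators of the connector: C(i + 1, j + 1) = α i j / M! where M = N − 1.
  module Numerator (M : ℕ) where

    α : ℕ → ℕ → ℕ
    α i j = (j P′ i) * (M ∸ suc i) !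

    σ-row : ∀ i n → suc i * σ (α i) n ≡ (n P′ suc i) * (M ∸ suc i) !
    σ-row i n = begin
      suc i * σ (α i) n                       ≡⟨ cong (suc i *_) (*-distribʳ-σ ((M ∸ suc i) !) (_P′ i) n) ⟨
      suc i * (σ (_P′ i) n * (M ∸ suc i) !)   ≡⟨ *-assoc (suc i) (σ (_P′ i) n) ((M ∸ suc i) !) ⟨
      suc i * σ (_P′ i) n * (M ∸ suc i) !     ≡⟨ cong (_* (M ∸ suc i) !) (hockey-stick i n) ⟩
      (n P′ suc i) * (M ∸ suc i) !            ∎
      where open ≡-Reasoning

    σ-row-< : ∀ i j → suc i * σ (α i) j ≡ (j ∸ i) * α i j
    σ-row-< i j = trans (σ-row i j) (*-assoc (j ∸ i) (j P′ i) _)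

    σ-row-≤ : ∀ i j → suc i * σ (α i) (suc j) ≡ suc j * α i j
    σ-row-≤ i j = trans (σ-row i (suc j))
      (trans (cong (_* (M ∸ suc i) !) (P′-suc j i)) (*-assoc (suc j) (j P′ i) _))

    σ-row-total : ∀ i → i < M → suc i * σ (α i) M ≡ M !
    σ-row-total i i<M = trans (σ-row i M) (P′*!≡! i<M)

    α-vanish : ∀ {i j} → j < i → α i j ≡ 0
    α-vanish j<i = cong (_* _) (P′-vanish j<i)

    α-suc : ∀ t j → j < M → (M ∸ suc t) * α (suc t) j ≡ (j ∸ t) * α t j
    α-suc t j j<M with suc t <? M
    ... | yes 1+t<M = begin
      (M ∸ suc t) * (((j ∸ t) * (j P′ t)) * (M ∸ suc (suc t)) !)
        ≡⟨ reorder (M ∸ suc t) (j ∸ t) (j P′ t) ((M ∸ suc (suc t)) !) ⟩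
      (j ∸ t) * ((j P′ t) * ((M ∸ suc t) * (M ∸ suc (suc t)) !))
        ≡⟨ cong (λ x → (j ∸ t) * ((j P′ t) * x)) (∸*!≡∸! 1+t<M) ⟩
      (j ∸ t) * α t j ∎
      where
      open ≡-Reasoning
      reorder : ∀ a b c d → a * ((b * c) * d) ≡ b * (c * (a * d))
      reorder = solve-∀
    ... | no 1+t≮M = begin
      (M ∸ suc t) * α (suc t) j ≡⟨ cong (_* α (suc t) j) (m≤n⇒m∸n≡0 M≤1+t) ⟩
      0                         ≡⟨ cong (_* α t j) (m≤n⇒m∸n≡0 (≤-pred (≤-trans j<M M≤1+t))) ⟨
      (j ∸ t) * α t j           ∎
      where
      open ≡-Reasoning
      M≤1+t = ≮⇒≥ 1+t≮M

    α-col-step : ∀ t j → j < M → (M ∸ j) * α t j + (M ∸ suc t) * α (suc t) j ≡ (M ∸ t) * α t j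
    α-col-step t j j<M = begin
      (M ∸ j) * α t j + (M ∸ suc t) * α (suc t) j ≡⟨ cong ((M ∸ j) * α t j +_) (α-suc t j j<M) ⟩
      (M ∸ j) * α t j + (j ∸ t) * α t j           ≡⟨ *-distribʳ-+ (α t j) (M ∸ j) (j ∸ t) ⟨
      ((M ∸ j) + (j ∸ t)) * α t j                 ≡⟨ factor (t ≤? j) ⟩
      (M ∸ t) * α t j                             ∎
      where
      open ≡-Reasoning
      factor : Dec (t ≤ j) → ((M ∸ j) + (j ∸ t)) * α t j ≡ (M ∸ t) * α t j
      factor (yes t≤j) = cong (_* α t j) (m∸n+n∸o≡m∸o t≤j (<⇒≤ j<M))
      factor (no t≰j) rewrite α-vanish (≰⇒> t≰j) =
        trans (*-zeroʳ (M ∸ j + (j ∸ t))) (sym (*-zeroʳ (M ∸ t)))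

    σ-col-from : ∀ i j → i ≤ M → j < M →
                 (M ∸ j) * σ (λ t → 𝟙 (i ≤ᵇ t) * α t j) M ≡ (M ∸ i) * α i j
    σ-col-from i j i≤M j<M = begin
      (M ∸ j) * σ (λ t → 𝟙 (i ≤ᵇ t) * α t j) M
        ≡⟨ cong (λ n → (M ∸ j) * σ (λ t → 𝟙 (i ≤ᵇ t) * α t j) n) i+d≡M ⟨
      (M ∸ j) * σ (λ t → 𝟙 (i ≤ᵇ t) * α t j) (i + d)
        ≡⟨ cong ((M ∸ j) *_) (σ-from (λ t → α t j) i d) ⟩
      (M ∸ j) * σ (λ e → α (i + e) j) d
        ≡⟨ *-distribˡ-σ (M ∸ j) (λ e → α (i + e) j) d ⟩
      σ (λ e → (M ∸ j) * α (i + e) j) d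
        ≡⟨ +-identityʳ _ ⟨
      σ (λ e → (M ∸ j) * α (i + e) j) d + 0
        ≡⟨ cong (σ (λ e → (M ∸ j) * α (i + e) j) d +_) Y[i+d]≡0 ⟨
      σ (λ e → (M ∸ j) * α (i + e) j) d + Y (i + d)
        ≡⟨ σ-telescope _ (λ e → Y (i + e)) d step ⟩
      Y (i + 0)
        ≡⟨ cong Y (+-identityʳ i) ⟩
      Y i ∎
      where
      open ≡-Reasoning
      Y : ℕ → ℕ
      Y t = (M ∸ t) * α t j
      d = M ∸ i
      i+d≡M : i + d ≡ M
      i+d≡M = m+[n∸m]≡n i≤M
      Y[i+d]≡0 : Y (i + d) ≡ 0
      Y[i+d]≡0 = cong (_* α (i + d) j) (trans (cong (M ∸_) i+d≡M) (n∸n≡0 M))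
      step : ∀ e → e < d → (M ∸ j) * α (i + e) j + Y (i + suc e) ≡ Y (i + e)
      step e _ = trans (cong (λ t → (M ∸ j) * α (i + e) j + Y t) (+-suc i e)) (α-col-step (i + e) j j<M)

    σ-col-after : ∀ i j → i < M → j < M →
                  (M ∸ j) * σ (λ t → 𝟙 (i <ᵇ t) * α t j) M ≡ (j ∸ i) * α i j
    σ-col-after i j i<M j<M = trans (σ-col-from (suc i) j i<M j<M) (α-suc i j j<M)

    σ-col-total : ∀ j → j < M → (M ∸ j) * σ (λ t → α t j) M ≡ M !
    σ-col-total j j<M = begin
      (M ∸ j) * σ (λ t → α t j) M              ≡⟨ cong ((M ∸ j) *_) (σ-cong M (λ t _ → *-identityˡ (α t j))) ⟨
      (M ∸ j) * σ (λ t → 𝟙 (0 ≤ᵇ t) * α t j) M ≡⟨ σ-col-from 0 j z≤n j<M ⟩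
      M * (1 * (M ∸ 1) !)                      ≡⟨ cong (M *_) (*-identityˡ ((M ∸ 1) !)) ⟩
      M * (M ∸ 1) !                            ≡⟨ ∸*!≡∸! (≤-trans (s≤s z≤n) j<M) ⟩
      M !                                      ∎
      where open ≡-Reasoning

open import Data.Rational using (_+_; _*_; _/_)
open ℚₚ
open ℚΣ
open +-*-Solver using (solve; _:*_; _:=_)

ι : ℕ → ℚ
ι n = ℤ.+ n / 1

fromℚᵘ-homo-+ : ∀ u v → fromℚᵘ (u ℚᵘ.+ v) ≡ fromℚᵘ u + fromℚᵘ v
fromℚᵘ-homo-+ u v = toℚᵘ-injective (ℚᵘ.≃-trans (toℚᵘ-fromℚᵘ (u ℚᵘ.+ v))
  (ℚᵘ.≃-trans (ℚᵘ.+-cong (ℚᵘ.≃-sym (toℚᵘ-fromℚᵘ u)) (ℚᵘ.≃-sym (toℚᵘ-fromℚᵘ v)))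
              (ℚᵘ.≃-sym (toℚᵘ-homo-+ (fromℚᵘ u) (fromℚᵘ v)))))

fromℚᵘ-homo-* : ∀ u v → fromℚᵘ (u ℚᵘ.* v) ≡ fromℚᵘ u * fromℚᵘ v
fromℚᵘ-homo-* u v = toℚᵘ-injective (ℚᵘ.≃-trans (toℚᵘ-fromℚᵘ (u ℚᵘ.* v))
  (ℚᵘ.≃-trans (ℚᵘ.*-cong (ℚᵘ.≃-sym (toℚᵘ-fromℚᵘ u)) (ℚᵘ.≃-sym (toℚᵘ-fromℚᵘ v)))
              (ℚᵘ.≃-sym (toℚᵘ-homo-* (fromℚᵘ u) (fromℚᵘ v)))))

ι-+ : ∀ m n → ι (m ℕ.+ n) ≡ ι m + ι n
ι-+ m n = trans (fromℚᵘ-cong {mkℚᵘ (ℤ.+ (m ℕ.+ n)) 0} {mkℚᵘ (ℤ.+ m) 0 ℚᵘ.+ mkℚᵘ (ℤ.+ n) 0} (*≡* m+n≡m+n))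
                (fromℚᵘ-homo-+ (mkℚᵘ (ℤ.+ m) 0) (mkℚᵘ (ℤ.+ n) 0))
  where
  m+n≡m+n : ℤ.+ (m ℕ.+ n) ℤ.* ℤ.+ 1 ≡ (ℤ.+ m ℤ.* ℤ.+ 1 ℤ.+ ℤ.+ n ℤ.* ℤ.+ 1) ℤ.* ℤ.+ 1
  m+n≡m+n = cong (ℤ._* ℤ.+ 1) (trans (ℤ.pos-+ m n)
    (sym (cong₂ ℤ._+_ (ℤ.*-identityʳ (ℤ.+ m)) (ℤ.*-identityʳ (ℤ.+ n)))))

ι-* : ∀ m n → ι (m ℕ.* n) ≡ ι m * ι n
ι-* m n = trans (fromℚᵘ-cong {mkℚᵘ (ℤ.+ (m ℕ.* n)) 0} {mkℚᵘ (ℤ.+ m) 0 ℚᵘ.* mkℚᵘ (ℤ.+ n) 0}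
                             (*≡* (cong (ℤ._* ℤ.+ 1) (ℤ.pos-* m n))))
                (fromℚᵘ-homo-* (mkℚᵘ (ℤ.+ m) 0) (mkℚᵘ (ℤ.+ n) 0))

inv-* : ∀ m n → inv (m ℕ.* n) ≡ inv m * inv n
inv-* zero    n       = sym (*-zeroˡ (inv n))
inv-* (suc m) zero    = trans (cong inv (ℕₚ.*-zeroʳ m)) (sym (*-zeroʳ (inv (suc m))))
inv-* (suc m) (suc n) =
  trans (fromℚᵘ-cong {mkℚᵘ (ℤ.+ 1) (n ℕ.+ m ℕ.* suc n)} {mkℚᵘ (ℤ.+ 1) m ℚᵘ.* mkℚᵘ (ℤ.+ 1) n} (*≡* refl))
        (fromℚᵘ-homo-* (mkℚᵘ (ℤ.+ 1) m) (mkℚᵘ (ℤ.+ 1) n))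

ι-*-inv : ∀ n .{{_ : NonZero n}} → ι n * inv n ≡ 1ℚ
ι-*-inv (suc n) = trans (sym (fromℚᵘ-homo-* (mkℚᵘ (ℤ.+ suc n) 0) (mkℚᵘ (ℤ.+ 1) n)))
  (fromℚᵘ-cong {mkℚᵘ (ℤ.+ suc n) 0 ℚᵘ.* mkℚᵘ (ℤ.+ 1) n} {mkℚᵘ (ℤ.+ 1) 0}
               (*≡* (cong (λ m → ℤ.+ suc m) (cross-multiplied n))))
  where
  cross-multiplied : ∀ n → n ℕ.* 1 ℕ.* 1 ≡ n ℕ.+ 0 ℕ.* suc n ℕ.+ 0 ℕ.* suc (n ℕ.+ 0 ℕ.* suc n)
  cross-multiplied = solve-∀

ι-𝟙 : ∀ b → ι (ℕΣ.𝟙 b) ≡ 𝟙 b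
ι-𝟙 true  = refl
ι-𝟙 false = refl

ι-σ : ∀ f n → ι (ℕΣ.σ f n) ≡ σ (λ s → ι (f s)) n
ι-σ f zero    = refl
ι-σ f (suc n) = trans (ι-+ (f 0) _) (cong (_+_ (ι (f 0))) (ι-σ (λ s → f (suc s)) n))

ι-cross : ∀ u v X Y .{{_ : NonZero u}} .{{_ : NonZero v}} →
          u ℕ.* X ≡ v ℕ.* Y → ι X * inv v ≡ ι Y * inv u
ι-cross u v X Y uX≡vY = begin
  ι X * inv v                   ≡⟨ *-identityʳ _ ⟨
  (ι X * inv v) * 1ℚ            ≡⟨ cong ((ι X * inv v) *_) (ι-*-inv u) ⟨
  (ι X * inv v) * (ι u * inv u) ≡⟨ interchange (ι X) (inv v) (ι u) (inv u) ⟩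
  (ι X * ι u) * (inv v * inv u) ≡⟨ cong (_* (inv v * inv u)) (trans (*-comm (ι X) (ι u)) (sym (ι-* u X))) ⟩
  ι (u ℕ.* X) * (inv v * inv u) ≡⟨ cong (λ z → ι z * (inv v * inv u)) uX≡vY ⟩
  ι (v ℕ.* Y) * (inv v * inv u) ≡⟨ cong (_* (inv v * inv u)) (ι-* v Y) ⟩
  (ι v * ι Y) * (inv v * inv u) ≡⟨ interchange (ι v) (ι Y) (inv v) (inv u) ⟩
  (ι v * inv v) * (ι Y * inv u) ≡⟨ cong (_* (ι Y * inv u)) (ι-*-inv v) ⟩
  1ℚ * (ι Y * inv u)            ≡⟨ *-identityˡ _ ⟩
  ι Y * inv u                   ∎
  where open ≡-Reasoning

ι-div : ∀ u X Y .{{_ : NonZero u}} → u ℕ.* X ≡ Y → ι X ≡ ι Y * inv u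
ι-div u X Y uX≡Y = trans (sym (*-identityʳ (ι X))) (ι-cross u 1 X Y (trans uX≡Y (sym (ℕₚ.*-identityˡ Y))))

module ConnectorKernel (M : ℕ) where

  open Numerator M

  κ : ℚ
  κ = inv (M !)

  A : ℕ → ℕ → ℚ
  A i j = ι (α i j) * κ

  B : ℕ → ℕ → ℚ
  B i j = ι (j ∸ i) * A i j

  σ-ι*κ : ∀ (c : ℕ → ℕ) n → σ (λ t → ι (c t) * κ) n ≡ ι (ℕΣ.σ c n) * κ
  σ-ι*κ c n = trans (sym (*-distribʳ-σ κ (λ t → ι (c t)) n)) (cong (_* κ) (sym (ι-σ c n)))

  σ-𝟙*A : ∀ (b : ℕ → Bool) j n →
          σ (λ t → 𝟙 (b t) * A t j) n ≡ ι (ℕΣ.σ (λ t → ℕΣ.𝟙 (b t) ℕ.* α t j) n) * κ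
  σ-𝟙*A b j n = trans (σ-cong n (λ t _ → 𝟙*A t)) (σ-ι*κ (λ t → ℕΣ.𝟙 (b t) ℕ.* α t j) n)
    where
    𝟙*A : ∀ t → 𝟙 (b t) * A t j ≡ ι (ℕΣ.𝟙 (b t) ℕ.* α t j) * κ
    𝟙*A t = begin
      𝟙 (b t) * (ι (α t j) * κ)      ≡⟨ *-assoc (𝟙 (b t)) (ι (α t j)) κ ⟨
      𝟙 (b t) * ι (α t j) * κ        ≡⟨ cong (λ x → x * ι (α t j) * κ) (ι-𝟙 (b t)) ⟨
      ι (ℕΣ.𝟙 (b t)) * ι (α t j) * κ ≡⟨ cong (_* κ) (ι-* (ℕΣ.𝟙 (b t)) (α t j)) ⟨
      ι (ℕΣ.𝟙 (b t) ℕ.* α t j) * κ   ∎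
      where open ≡-Reasoning

  A-col-from : ∀ i j → i < M → j < M →
               inv (M ∸ i) * σ (λ t → 𝟙 (i ≤ᵇ t) * A t j) M ≡ A i j * inv (M ∸ j)
  A-col-from i j i<M j<M = begin
    inv (M ∸ i) * σ (λ t → 𝟙 (i ≤ᵇ t) * A t j) M ≡⟨ cong (inv (M ∸ i) *_) (σ-𝟙*A (i ≤ᵇ_) j M) ⟩
    inv (M ∸ i) * (ι X * κ)                      ≡⟨ x∙yz≈yx∙z (inv (M ∸ i)) (ι X) κ ⟩
    (ι X * inv (M ∸ i)) * κ                      ≡⟨ cong (_* κ) (ι-cross (M ∸ j) (M ∸ i) X (α i j) column) ⟩
    (ι (α i j) * inv (M ∸ j)) * κ                ≡⟨ xy∙z≈xz∙y (ι (α i j)) (inv (M ∸ j)) κ ⟩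
    A i j * inv (M ∸ j)                          ∎
    where
    open ≡-Reasoning
    X = ℕΣ.σ (λ t → ℕΣ.𝟙 (i ≤ᵇ t) ℕ.* α t j) M
    column = σ-col-from i j (ℕₚ.<⇒≤ i<M) j<M
    instance
      _ = >-nonZero (ℕₚ.m<n⇒0<n∸m i<M)
      _ = >-nonZero (ℕₚ.m<n⇒0<n∸m j<M)

  A-col-after : ∀ i j → i < M → j < M →
                σ (λ t → 𝟙 (i <ᵇ t) * A t j) M ≡ B i j * inv (M ∸ j)
  A-col-after i j i<M j<M = begin
    σ (λ t → 𝟙 (i <ᵇ t) * A t j) M          ≡⟨ σ-𝟙*A (i <ᵇ_) j M ⟩
    ι X * κ                                 ≡⟨ cong (_* κ) (ι-div (M ∸ j) X Y (σ-col-after i j i<M j<M)) ⟩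
    ι Y * inv (M ∸ j) * κ                   ≡⟨ xy∙z≈xz∙y (ι Y) (inv (M ∸ j)) κ ⟩
    ι Y * κ * inv (M ∸ j)                   ≡⟨ cong (λ x → x * κ * inv (M ∸ j)) (ι-* (j ∸ i) (α i j)) ⟩
    ι (j ∸ i) * ι (α i j) * κ * inv (M ∸ j) ≡⟨ cong (_* inv (M ∸ j)) (*-assoc (ι (j ∸ i)) (ι (α i j)) κ) ⟩
    B i j * inv (M ∸ j)                     ∎
    where
    open ≡-Reasoning
    X = ℕΣ.σ (λ t → ℕΣ.𝟙 (i <ᵇ t) ℕ.* α t j) M
    Y = (j ∸ i) ℕ.* α i j
    instance _ = >-nonZero (ℕₚ.m<n⇒0<n∸m j<M)

  A-col-total : ∀ j → j < M → σ (λ t → A t j) M ≡ inv (M ∸ j)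
  A-col-total j j<M = begin
    σ (λ t → A t j) M         ≡⟨ σ-ι*κ (λ t → α t j) M ⟩
    ι X * κ                   ≡⟨ cong (_* κ) (ι-div (M ∸ j) X (M !) (σ-col-total j j<M)) ⟩
    ι (M !) * inv (M ∸ j) * κ ≡⟨ xy∙z≈xz∙y (ι (M !)) (inv (M ∸ j)) κ ⟩
    ι (M !) * κ * inv (M ∸ j) ≡⟨ cong (_* inv (M ∸ j)) (ι-*-inv (M !)) ⟩
    1ℚ * inv (M ∸ j)          ≡⟨ *-identityˡ (inv (M ∸ j)) ⟩
    inv (M ∸ j)               ∎
    where
    open ≡-Reasoning
    X = ℕΣ.σ (λ t → α t j) M
    instance
      _ = >-nonZero (ℕₚ.m<n⇒0<n∸m j<M)
      _ = M ℕₚ.!≢0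

  σ-A-prefix : ∀ i n → n ≤ M → σ (λ s → A i s * 𝟙 (s <ᵇ n)) M ≡ ι (ℕΣ.σ (α i) n) * κ
  σ-A-prefix i n n≤M = trans (σ-truncate (A i) n≤M) (σ-ι*κ (α i) n)

  A-row-≤ : ∀ i j → j < M → inv (suc i) * A i j ≡ σ (λ s → A i s * 𝟙 (s ≤ᵇ j)) M * inv (suc j)
  A-row-≤ i j j<M = sym (begin
    σ (λ s → A i s * 𝟙 (s ≤ᵇ j)) M * inv (suc j)
      ≡⟨ cong (_* inv (suc j)) (σ-cong M (λ s _ → cong (λ b → A i s * 𝟙 b) (sym (m<ᵇ1+n≡m≤ᵇn s j)))) ⟩
    σ (λ s → A i s * 𝟙 (s <ᵇ suc j)) M * inv (suc j)
      ≡⟨ cong (_* inv (suc j)) (σ-A-prefix i (suc j) j<M) ⟩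
    ι X * κ * inv (suc j)
      ≡⟨ xy∙z≈xz∙y (ι X) κ (inv (suc j)) ⟩
    ι X * inv (suc j) * κ
      ≡⟨ cong (_* κ) (ι-cross (suc i) (suc j) X (α i j) (σ-row-≤ i j)) ⟩
    ι (α i j) * inv (suc i) * κ
      ≡⟨ xy∙z≈xz∙y (ι (α i j)) (inv (suc i)) κ ⟩
    A i j * inv (suc i)
      ≡⟨ *-comm (A i j) (inv (suc i)) ⟩
    inv (suc i) * A i j ∎)
    where
    open ≡-Reasoning
    X = ℕΣ.σ (α i) (suc j)

  A-row-< : ∀ i j → j ≤ M → inv (suc i) * B i j ≡ σ (λ s → A i s * 𝟙 (s <ᵇ j)) M
  A-row-< i j j≤M = sym (begin
    σ (λ s → A i s * 𝟙 (s <ᵇ j)) M           ≡⟨ σ-A-prefix i j j≤M ⟩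
    ι X * κ                                 ≡⟨ cong (_* κ) (ι-div (suc i) X Y (σ-row-< i j)) ⟩
    ι Y * inv (suc i) * κ                   ≡⟨ cong (λ x → x * inv (suc i) * κ) (ι-* (j ∸ i) (α i j)) ⟩
    ι (j ∸ i) * ι (α i j) * inv (suc i) * κ ≡⟨ reorder (ι (j ∸ i)) (ι (α i j)) (inv (suc i)) κ ⟩
    inv (suc i) * B i j                     ∎)
    where
    open ≡-Reasoning
    X = ℕΣ.σ (α i) j
    Y = (j ∸ i) ℕ.* α i j
    reorder : ∀ a b c d → a * b * c * d ≡ c * (a * (b * d))
    reorder = solve 4 (λ a b c d → a :* b :* c :* d := c :* (a :* (b :* d))) refl

  A-row-total : ∀ i → i < M → σ (A i) M ≡ inv (suc i)
  A-row-total i i<M = begin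
    σ (A i) M                 ≡⟨ σ-ι*κ (α i) M ⟩
    ι X * κ                   ≡⟨ cong (_* κ) (ι-div (suc i) X (M !) (σ-row-total i i<M)) ⟩
    ι (M !) * inv (suc i) * κ ≡⟨ xy∙z≈xz∙y (ι (M !)) (inv (suc i)) κ ⟩
    ι (M !) * κ * inv (suc i) ≡⟨ cong (_* inv (suc i)) (ι-*-inv (M !)) ⟩
    1ℚ * inv (suc i)          ≡⟨ *-identityˡ (inv (suc i)) ⟩
    inv (suc i)               ∎
    where
    open ≡-Reasoning
    X = ℕΣ.σ (α i) M
    instance _ = M ℕₚ.!≢0

data Letter : Set where
  L K : Letter

data EndsInK : Letter → List Letter → Set where
  end : EndsInK K []
  _∷_ : ∀ {b c w} → EndsInK c w → EndsInK b (c ∷ w)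

-- A function f : Fn stands for m ↦ f (m − 1) on the summation range 1 ≤ m ≤ M = N − 1,
-- which is where _≈_ compares functions.
module Operators (M : ℕ) where

  open ConnectorKernel M

  Fn : Set
  Fn = ℕ → ℚ

  infix 4 _≈_
  _≈_ : Fn → Fn → Set
  f ≈ g = ∀ j → j < M → f j ≡ g j

  ⟪_⟫ : (ℕ → ℕ → ℚ) → Fn → Fn
  ⟪ k ⟫ g i = σ (λ j → k i j * g j) M

  S W D E : Fn → Fn
  S = ⟪ (λ i j → 𝟙 (i <ᵇ j)) ⟫
  W = ⟪ (λ i j → 𝟙 (i ≤ᵇ j)) ⟫
  D f j = inv (M ∸ j) * f j
  E f j = inv (suc j) * f j

  ⟪⟫-cong : ∀ k {f g} → f ≈ g → ⟪ k ⟫ f ≈ ⟪ k ⟫ g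
  ⟪⟫-cong k f≈g i _ = σ-cong M (λ j j<M → cong (k i j *_) (f≈g j j<M))

  S-cong : ∀ {f g} → f ≈ g → S f ≈ S g
  S-cong = ⟪⟫-cong (λ i j → 𝟙 (i <ᵇ j))

  W-cong : ∀ {f g} → f ≈ g → W f ≈ W g
  W-cong = ⟪⟫-cong (λ i j → 𝟙 (i ≤ᵇ j))

  D-cong : ∀ {f g} → f ≈ g → D f ≈ D g
  D-cong f≈g i i<M = cong (inv (M ∸ i) *_) (f≈g i i<M)

  E-cong : ∀ {f g} → f ≈ g → E f ≈ E g
  E-cong f≈g i i<M = cong (inv (suc i) *_) (f≈g i i<M)

  fold-cong : ∀ (T : Fn → Fn) → (∀ {f g} → f ≈ g → T f ≈ T g) →
              ∀ {f g} n → f ≈ g → fold f T n ≈ fold g T n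
  fold-cong T T-cong zero    f≈g = f≈g
  fold-cong T T-cong (suc n) f≈g = T-cong (fold-cong T T-cong n f≈g)

  DW-A : ∀ g → D (W (⟪ A ⟫ g)) ≈ ⟪ A ⟫ (D g)
  DW-A g i i<M = begin
    inv (M ∸ i) * σ (λ t → 𝟙 (i ≤ᵇ t) * σ (λ s → A t s * g s) M) M
      ≡⟨ cong (inv (M ∸ i) *_) (σ-kernel-assoc (λ t → 𝟙 (i ≤ᵇ t)) A g M M) ⟩
    inv (M ∸ i) * σ (λ s → c s * g s) M
      ≡⟨ *-distribˡ-σ (inv (M ∸ i)) (λ s → c s * g s) M ⟩
    σ (λ s → inv (M ∸ i) * (c s * g s)) M
      ≡⟨ σ-cong M (λ s s<M → begin
           inv (M ∸ i) * (c s * g s)   ≡⟨ *-assoc (inv (M ∸ i)) (c s) (g s) ⟨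
           inv (M ∸ i) * c s * g s     ≡⟨ cong (_* g s) (A-col-from i s i<M s<M) ⟩
           A i s * inv (M ∸ s) * g s   ≡⟨ *-assoc (A i s) (inv (M ∸ s)) (g s) ⟩
           A i s * (inv (M ∸ s) * g s) ∎) ⟩
    ⟪ A ⟫ (D g) i ∎
    where
    open ≡-Reasoning
    c : ℕ → ℚ
    c s = σ (λ t → 𝟙 (i ≤ᵇ t) * A t s) M

  S-A : ∀ g → S (⟪ A ⟫ g) ≈ ⟪ B ⟫ (D g)
  S-A g i i<M = begin
    σ (λ t → 𝟙 (i <ᵇ t) * σ (λ s → A t s * g s) M) M
      ≡⟨ σ-kernel-assoc (λ t → 𝟙 (i <ᵇ t)) A g M M ⟩
    σ (λ s → σ (λ t → 𝟙 (i <ᵇ t) * A t s) M * g s) M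
      ≡⟨ σ-cong M (λ s s<M → trans (cong (_* g s) (A-col-after i s i<M s<M)) (*-assoc (B i s) (inv (M ∸ s)) (g s))) ⟩
    ⟪ B ⟫ (D g) i ∎
    where open ≡-Reasoning

  E-A : ∀ g → E (⟪ A ⟫ g) ≈ ⟪ A ⟫ (W (E g))
  E-A g i i<M = sym (begin
    σ (λ s → A i s * σ (λ u → 𝟙 (s ≤ᵇ u) * E g u) M) M
      ≡⟨ σ-kernel-assoc (A i) (λ s u → 𝟙 (s ≤ᵇ u)) (E g) M M ⟩
    σ (λ u → r u * (inv (suc u) * g u)) M
      ≡⟨ σ-cong M (λ u u<M → begin
           r u * (inv (suc u) * g u)   ≡⟨ *-assoc (r u) (inv (suc u)) (g u) ⟨
           r u * inv (suc u) * g u     ≡⟨ cong (_* g u) (A-row-≤ i u u<M) ⟨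
           inv (suc i) * A i u * g u   ≡⟨ *-assoc (inv (suc i)) (A i u) (g u) ⟩
           inv (suc i) * (A i u * g u) ∎) ⟩
    σ (λ u → inv (suc i) * (A i u * g u)) M
      ≡⟨ *-distribˡ-σ (inv (suc i)) (λ u → A i u * g u) M ⟨
    E (⟪ A ⟫ g) i ∎)
    where
    open ≡-Reasoning
    r : ℕ → ℚ
    r u = σ (λ s → A i s * 𝟙 (s ≤ᵇ u)) M

  E-B : ∀ g → E (⟪ B ⟫ g) ≈ ⟪ A ⟫ (S g)
  E-B g i i<M = sym (begin
    σ (λ s → A i s * σ (λ u → 𝟙 (s <ᵇ u) * g u) M) M
      ≡⟨ σ-kernel-assoc (A i) (λ s u → 𝟙 (s <ᵇ u)) g M M ⟩
    σ (λ u → σ (λ s → A i s * 𝟙 (s <ᵇ u)) M * g u) M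
      ≡⟨ σ-cong M (λ u u<M → trans (sym (*-assoc (inv (suc i)) (B i u) (g u)))
                                   (cong (_* g u) (A-row-< i u (ℕₚ.<⇒≤ u<M)))) ⟨
    σ (λ u → inv (suc i) * (B i u * g u)) M
      ≡⟨ *-distribˡ-σ (inv (suc i)) (λ u → B i u * g u) M ⟨
    E (⟪ B ⟫ g) i ∎)
    where open ≡-Reasoning

  E-1 : E (λ _ → 1ℚ) ≈ ⟪ A ⟫ (λ _ → 1ℚ)
  E-1 i i<M = begin
    inv (suc i) * 1ℚ   ≡⟨ *-identityʳ (inv (suc i)) ⟩
    inv (suc i)        ≡⟨ A-row-total i i<M ⟨
    σ (A i) M          ≡⟨ σ-cong M (λ s _ → *-identityʳ (A i s)) ⟨
    ⟪ A ⟫ (λ _ → 1ℚ) i ∎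
    where open ≡-Reasoning

  σ-A : ∀ g → σ (⟪ A ⟫ g) M ≡ σ (D g) M
  σ-A g = begin
    σ (λ t → σ (λ s → A t s * g s) M) M ≡⟨ σ-comm (λ t s → A t s * g s) M M ⟩
    σ (λ s → σ (λ t → A t s * g s) M) M ≡⟨ σ-cong M (λ s s<M → column s s<M) ⟩
    σ (D g) M                           ∎
    where
    open ≡-Reasoning
    column : ∀ s → s < M → σ (λ t → A t s * g s) M ≡ inv (M ∸ s) * g s
    column s s<M = trans (sym (*-distribʳ-σ (g s) (λ t → A t s) M)) (cong (_* g s) (A-col-total s s<M))

  -- How ζ_N, resp. ζ♭_N, reads the letter b when it follows the letter a.
  ζ-step : Letter → Letter → Fn → Fn
  ζ-step L L g = D (W g)
  ζ-step L K   = E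
  ζ-step K K   = E
  ζ-step K L   = S

  ζ♭-step : Letter → Letter → Fn → Fn
  ζ♭-step L _   = D
  ζ♭-step K K g = W (E g)
  ζ♭-step K L   = S

  connector : Letter → Letter → Fn → Fn
  connector L _ = ⟪ A ⟫
  connector K K = ⟪ A ⟫
  connector K L = ⟪ B ⟫

  ζ-word ζ♭-word : Letter → List Letter → Fn
  ζ-word  a []      _ = 1ℚ
  ζ-word  a (b ∷ w)   = ζ-step a b (ζ-word b w)
  ζ♭-word a []      _ = 1ℚ
  ζ♭-word a (b ∷ w)   = ζ♭-step a b (ζ♭-word b w)

  ζ-step-cong : ∀ a b {f g} → f ≈ g → ζ-step a b f ≈ ζ-step a b g
  ζ-step-cong L L f≈g = D-cong (W-cong f≈g)
  ζ-step-cong L K     = E-cong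
  ζ-step-cong K K     = E-cong
  ζ-step-cong K L     = S-cong

  connector-step : ∀ a b c g → ζ-step a b (connector b c g) ≈ connector a b (ζ♭-step b c g)
  connector-step L L c g = DW-A g
  connector-step K L c g = S-A g
  connector-step L K K g = E-A g
  connector-step K K K g = E-A g
  connector-step L K L g = E-B g
  connector-step K K L g = E-B g

  ζ-word≈connector : ∀ a {b w} → EndsInK b w → ζ-word a (b ∷ w) ≈ connector a b (ζ♭-word b w)
  ζ-word≈connector L end = E-1
  ζ-word≈connector K end = E-1
  ζ-word≈connector a {b} (_∷_ {c = c} {w = w} e) i i<M = trans
    (ζ-step-cong a b (ζ-word≈connector b e) i i<M)
    (connector-step a b c (ζ♭-word c w) i i<M)

  word-duality : ∀ {w} → EndsInK L w → σ (ζ-word L w) M ≡ σ (ζ♭-word L w) M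
  word-duality (_∷_ {c = c} {w = w} e) = trans (σ-cong M (ζ-word≈connector L e)) (σ-A (ζ♭-word c w))

sumℚ-++ : ∀ xs ys → sumℚ (xs ++ ys) ≡ sumℚ xs + sumℚ ys
sumℚ-++ []       ys = sym (+-identityˡ (sumℚ ys))
sumℚ-++ (x ∷ xs) ys = trans (cong (x +_) (sumℚ-++ xs ys)) (sym (+-assoc x (sumℚ xs) (sumℚ ys)))

sumℚ-map-concatMap : ∀ {A B : Set} (F : B → ℚ) (g : A → List B) xs →
                     sumℚ (map F (concatMap g xs)) ≡ sumℚ (map (λ x → sumℚ (map F (g x))) xs)
sumℚ-map-concatMap F g []       = refl
sumℚ-map-concatMap F g (x ∷ xs) = begin
  sumℚ (map F (g x ++ concatMap g xs))
    ≡⟨ cong sumℚ (map-++ F (g x) (concatMap g xs)) ⟩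
  sumℚ (map F (g x) ++ map F (concatMap g xs))
    ≡⟨ sumℚ-++ (map F (g x)) _ ⟩
  sumℚ (map F (g x)) + sumℚ (map F (concatMap g xs))
    ≡⟨ cong (sumℚ (map F (g x)) +_) (sumℚ-map-concatMap F g xs) ⟩
  sumℚ (map (λ x → sumℚ (map F (g x))) (x ∷ xs)) ∎
  where open ≡-Reasoning

sumℚ-map-cong : ∀ {A : Set} {F G : A → ℚ} xs → (∀ x → F x ≡ G x) → sumℚ (map F xs) ≡ sumℚ (map G xs)
sumℚ-map-cong xs F≗G = cong sumℚ (map-cong F≗G xs)

sumℚ-map-∘ : ∀ {A B : Set} (F : B → ℚ) (h : A → B) xs →
             sumℚ (map F (map h xs)) ≡ sumℚ (map (λ x → F (h x)) xs)
sumℚ-map-∘ F h xs = cong sumℚ (sym (map-∘ xs))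

*-distribˡ-sumℚ : ∀ {A : Set} c (F : A → ℚ) xs → c * sumℚ (map F xs) ≡ sumℚ (map (λ x → c * F x) xs)
*-distribˡ-sumℚ c F []       = *-zeroʳ c
*-distribˡ-sumℚ c F (x ∷ xs) = trans (*-distribˡ-+ c (F x) _) (cong (c * F x +_) (*-distribˡ-sumℚ c F xs))

sumℚ-filterᵇ : ∀ {A : Set} (F : A → ℚ) (P : A → Bool) xs →
               sumℚ (map F (filterᵇ P xs)) ≡ sumℚ (map (λ x → 𝟙 (P x) * F x) xs)
sumℚ-filterᵇ F P []       = refl
sumℚ-filterᵇ F P (x ∷ xs) with P x
... | true  = cong₂ _+_ (sym (*-identityˡ (F x))) (sumℚ-filterᵇ F P xs)
... | false = trans (sumℚ-filterᵇ F P xs) (sym (trans (cong (_+ _) (*-zeroˡ (F x))) (+-identityˡ _)))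

sumℚ-applyUpTo : ∀ (g : ℕ → ℚ) n → sumℚ (applyUpTo g n) ≡ σ g n
sumℚ-applyUpTo g zero    = refl
sumℚ-applyUpTo g (suc n) = cong (g 0 +_) (sumℚ-applyUpTo (λ j → g (suc j)) n)

sumℚ-range : ∀ (F : ℕ → ℚ) M → sumℚ (map F (range (suc M))) ≡ σ (λ j → F (suc j)) M
sumℚ-range F M = begin
  sumℚ (map F (map suc (upTo M)))       ≡⟨ sumℚ-map-∘ F suc (upTo M) ⟩
  sumℚ (map (λ j → F (suc j)) (upTo M)) ≡⟨ cong sumℚ (map-applyUpTo (λ j → j) (λ j → F (suc j)) M) ⟩
  sumℚ (applyUpTo (λ j → F (suc j)) M)  ≡⟨ sumℚ-applyUpTo (λ j → F (suc j)) M ⟩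
  σ (λ j → F (suc j)) M                 ∎
  where open ≡-Reasoning

sumℚ-tuples-suc : ∀ M n (G : List ℕ → ℚ) →
  sumℚ (map G (tuples (suc M) (suc n))) ≡ σ (λ j → sumℚ (map (λ b → G (suc j ∷ b)) (tuples (suc M) n))) M
sumℚ-tuples-suc M n G = begin
  sumℚ (map G (concatMap (λ x → map (x ∷_) T) (range (suc M))))
    ≡⟨ sumℚ-map-concatMap G (λ x → map (x ∷_) T) (range (suc M)) ⟩
  sumℚ (map (λ x → sumℚ (map G (map (x ∷_) T))) (range (suc M)))
    ≡⟨ sumℚ-range (λ x → sumℚ (map G (map (x ∷_) T))) M ⟩
  σ (λ j → sumℚ (map G (map (suc j ∷_) T))) M
    ≡⟨ σ-cong M (λ j _ → sumℚ-map-∘ G (suc j ∷_) T) ⟩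
  σ (λ j → sumℚ (map (λ b → G (suc j ∷ b)) T)) M ∎
  where
  open ≡-Reasoning
  T = tuples (suc M) n

sumℚ-configs-∷ : ∀ N l ls (G : List (List ℕ) → ℚ) →
  sumℚ (map G (configs N (l ∷ ls))) ≡ sumℚ (map (λ b → sumℚ (map (λ c → G (b ∷ c)) (configs N ls))) (tuples N l))
sumℚ-configs-∷ N l ls G = trans (sumℚ-map-concatMap G (λ b → map (b ∷_) (configs N ls)) (tuples N l))
  (sumℚ-map-cong (tuples N l) (λ b → sumℚ-map-∘ G (b ∷_) (configs N ls)))

onHead : ∀ {A : Set} → (A → Bool) → List A → Bool
onHead p []      = true
onHead p (x ∷ _) = p x

lastFrom : ℕ → List ℕ → ℕ
lastFrom x []      = x
lastFrom x (y ∷ b) = lastFrom y b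

sep≡onHead : ∀ x b c → sep (x ∷ b) c ≡ onHead (lastFrom x b <ᵇ_) c
sep≡onHead x []       []      = refl
sep≡onHead x []       (y ∷ c) = refl
sep≡onHead x (x′ ∷ b) c       = sep≡onHead x′ b c

admissible-∷ : ∀ x b c →
  admissible ((x ∷ b) ∷ c) ≡ weakInc (x ∷ b) ∧ (onHead (onHead (lastFrom x b <ᵇ_)) c ∧ admissible c)
admissible-∷ x b []       = sym (∧-identityʳ (weakInc (x ∷ b)))
admissible-∷ x b (b′ ∷ c) = cong (λ s → weakInc (x ∷ b) ∧ (s ∧ admissible (b′ ∷ c))) (sep≡onHead x b b′)

onHead-true : ∀ c → onHead (onHead (λ (_ : ℕ) → true)) c ≡ true
onHead-true []            = refl
onHead-true ([] ∷ c)      = refl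
onHead-true ((x ∷ b) ∷ c) = refl

-- cons x y stands for the entries suc x of l and suc y of k.
data IndexPair : List ℕ → List ℕ → Set where
  []   : IndexPair [] []
  cons : ∀ x y {xs ys} → IndexPair xs ys → IndexPair (suc x ∷ xs) (suc y ∷ ys)

swap : ∀ {xs ys} → IndexPair xs ys → IndexPair ys xs
swap []           = []
swap (cons x y i) = cons y x (swap i)

module Bridge (M : ℕ) where

  open Operators M

  N : ℕ
  N = suc M

  module BlockSums
    (w : ℕ → List ℕ → ℚ)
    (weight : List ℕ → List (List ℕ) → ℚ)
    (weight-[] : weight [] [] ≡ 1ℚ)
    (weight-∷ : ∀ e es b c → weight (e ∷ es) (b ∷ c) ≡ w e b * weight es c)
    (V : ℕ → ℕ → Fn → Fn)
    (block-sum : ∀ e n (H : ℕ → ℚ) j →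
       sumℚ (map (λ b → 𝟙 (weakInc (suc j ∷ b)) * (w e (suc j ∷ b) * H (lastFrom (suc j) b))) (tuples N n))
         ≡ V e n (λ u → H (suc u)) j)
    where

    -- p is the condition that the preceding block imposes on the first entry.
    nested-sum : ∀ {xs ys} → IndexPair xs ys → (ℕ → Bool) → ℚ
    nested-sum []           p = 1ℚ
    nested-sum (cons x y i) p = σ (λ j → 𝟙 (p (suc j)) * V (suc y) x (λ u → nested-sum i (suc u <ᵇ_)) j) M

    sum-configs : ∀ {xs ys} (i : IndexPair xs ys) p →
      sumℚ (map (λ c → 𝟙 (onHead (onHead p) c ∧ admissible c) * weight ys c) (configs N xs)) ≡ nested-sum i p
    sum-configs []                     p = trans (+-identityʳ _) (trans (*-identityˡ (weight [] [])) weight-[])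
    sum-configs (cons x y {xs} {ys} i) p = begin
      sumℚ (map G (configs N (suc x ∷ xs)))
        ≡⟨ sumℚ-configs-∷ N (suc x) xs G ⟩
      sumℚ (map (λ b → sumℚ (map (λ c → G (b ∷ c)) (configs N xs))) (tuples N (suc x)))
        ≡⟨ sumℚ-tuples-suc M x (λ b → sumℚ (map (λ c → G (b ∷ c)) (configs N xs))) ⟩
      σ (λ j → sumℚ (map (λ b → sumℚ (map (λ c → G ((suc j ∷ b) ∷ c)) (configs N xs))) (tuples N x))) M
        ≡⟨ σ-cong M (λ j _ → sum-first-block j) ⟩
      nested-sum (cons x y i) p ∎
      where
      open ≡-Reasoning
      G : List (List ℕ) → ℚ
      G c = 𝟙 (onHead (onHead p) c ∧ admissible c) * weight (suc y ∷ ys) c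
      H : ℕ → ℚ
      H v = nested-sum i (v <ᵇ_)
      rest : ℕ → List (List ℕ) → ℚ
      rest v c = 𝟙 (onHead (onHead (v <ᵇ_)) c ∧ admissible c) * weight ys c

      split : ∀ j b c → G ((suc j ∷ b) ∷ c) ≡
        𝟙 (p (suc j)) * (𝟙 (weakInc (suc j ∷ b)) * (w (suc y) (suc j ∷ b) * rest (lastFrom (suc j) b) c))
      split j b c = begin
        𝟙 (p (suc j) ∧ admissible (B ∷ c)) * weight (suc y ∷ ys) (B ∷ c)
          ≡⟨ cong₂ (λ a z → 𝟙 (p (suc j) ∧ a) * z) (admissible-∷ (suc j) b c) (weight-∷ (suc y) ys B c) ⟩
        𝟙 (p (suc j) ∧ (weakInc B ∧ r)) * (w (suc y) B * weight ys c)
          ≡⟨ cong (_* (w (suc y) B * weight ys c))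
                  (trans (𝟙-∧ (p (suc j)) _) (cong (𝟙 (p (suc j)) *_) (𝟙-∧ (weakInc B) r))) ⟩
        (𝟙 (p (suc j)) * (𝟙 (weakInc B) * 𝟙 r)) * (w (suc y) B * weight ys c)
          ≡⟨ reorder (𝟙 (p (suc j))) (𝟙 (weakInc B)) (𝟙 r) (w (suc y) B) (weight ys c) ⟩
        𝟙 (p (suc j)) * (𝟙 (weakInc B) * (w (suc y) B * (𝟙 r * weight ys c))) ∎
        where
        B = suc j ∷ b
        r = onHead (onHead (lastFrom (suc j) b <ᵇ_)) c ∧ admissible c
        reorder : ∀ a b c d e → (a * (b * c)) * (d * e) ≡ a * (b * (d * (c * e)))
        reorder = solve 5 (λ a b c d e → (a :* (b :* c)) :* (d :* e) := a :* (b :* (d :* (c :* e)))) refl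

      sum-rest : ∀ j b → sumℚ (map (λ c → G ((suc j ∷ b) ∷ c)) (configs N xs)) ≡
        𝟙 (p (suc j)) * (𝟙 (weakInc (suc j ∷ b)) * (w (suc y) (suc j ∷ b) * H (lastFrom (suc j) b)))
      sum-rest j b = begin
        sumℚ (map (λ c → G (B ∷ c)) cs)                ≡⟨ sumℚ-map-cong cs (split j b) ⟩
        sumℚ (map (λ c → a * (ω * (β * rest v c))) cs) ≡⟨ *-distribˡ-sumℚ a (λ c → ω * (β * rest v c)) cs ⟨
        a * sumℚ (map (λ c → ω * (β * rest v c)) cs)   ≡⟨ cong (a *_) (*-distribˡ-sumℚ ω (λ c → β * rest v c) cs) ⟨
        a * (ω * sumℚ (map (λ c → β * rest v c) cs))   ≡⟨ cong (λ z → a * (ω * z)) (*-distribˡ-sumℚ β (rest v) cs) ⟨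
        a * (ω * (β * sumℚ (map (rest v) cs)))         ≡⟨ cong (λ z → a * (ω * (β * z))) (sum-configs i (v <ᵇ_)) ⟩
        a * (ω * (β * H v))                            ∎
        where
        B = suc j ∷ b
        v = lastFrom (suc j) b
        cs = configs N xs
        a = 𝟙 (p (suc j))
        ω = 𝟙 (weakInc B)
        β = w (suc y) B

      sum-first-block : ∀ j →
        sumℚ (map (λ b → sumℚ (map (λ c → G ((suc j ∷ b) ∷ c)) (configs N xs))) (tuples N x)) ≡
        𝟙 (p (suc j)) * V (suc y) x (λ u → nested-sum i (suc u <ᵇ_)) j
      sum-first-block j = begin
        sumℚ (map (λ b → sumℚ (map (λ c → G ((suc j ∷ b) ∷ c)) (configs N xs))) (tuples N x))
          ≡⟨ sumℚ-map-cong (tuples N x) (sum-rest j) ⟩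
        sumℚ (map (λ b → 𝟙 (p (suc j)) * F b) (tuples N x))
          ≡⟨ *-distribˡ-sumℚ (𝟙 (p (suc j))) F (tuples N x) ⟨
        𝟙 (p (suc j)) * sumℚ (map F (tuples N x))
          ≡⟨ cong (𝟙 (p (suc j)) *_) (block-sum (suc y) x H j) ⟩
        𝟙 (p (suc j)) * V (suc y) x (λ u → nested-sum i (suc u <ᵇ_)) j ∎
        where
        F : List ℕ → ℚ
        F b = 𝟙 (weakInc (suc j ∷ b)) * (w (suc y) (suc j ∷ b) * H (lastFrom (suc j) b))

    sum-admissible : ∀ {xs ys} (i : IndexPair xs ys) →
      sumℚ (map (weight ys) (filterᵇ admissible (configs N xs))) ≡ nested-sum i (λ _ → true)
    sum-admissible {xs} {ys} i = begin
      sumℚ (map (weight ys) (filterᵇ admissible (configs N xs)))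
        ≡⟨ sumℚ-filterᵇ (weight ys) admissible (configs N xs) ⟩
      sumℚ (map (λ c → 𝟙 (admissible c) * weight ys c) (configs N xs))
        ≡⟨ sumℚ-map-cong (configs N xs) (λ c → cong (λ b → 𝟙 (b ∧ admissible c) * weight ys c) (onHead-true c)) ⟨
      sumℚ (map (λ c → 𝟙 (onHead (onHead (λ _ → true)) c ∧ admissible c) * weight ys c) (configs N xs))
        ≡⟨ sum-configs i (λ _ → true) ⟩
      nested-sum i (λ _ → true) ∎
      where open ≡-Reasoning

  fold-scale : ∀ (c : ℕ → ℕ) G e j → fold G (λ f i → inv (c i) * f i) e j ≡ inv (c j ^ e) * G j
  fold-scale c G zero    j = sym (*-identityˡ (G j))
  fold-scale c G (suc e) j = begin
    inv (c j) * fold G (λ f i → inv (c i) * f i) e j ≡⟨ cong (inv (c j) *_) (fold-scale c G e j) ⟩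
    inv (c j) * (inv (c j ^ e) * G j)                 ≡⟨ *-assoc (inv (c j)) (inv (c j ^ e)) (G j) ⟨
    inv (c j) * inv (c j ^ e) * G j                   ≡⟨ cong (_* G j) (inv-* (c j) (c j ^ e)) ⟨
    inv (c j ^ suc e) * G j                           ∎
    where open ≡-Reasoning

  ζ-block : ℕ → ℕ → Fn → Fn
  ζ-block e n G = fold (fold G E e) (λ g → D (W g)) n

  ζ♭-block : ℕ → ℕ → Fn → Fn
  ζ♭-block e n G = fold (fold G (λ g → W (E g)) n) D e

  ζ-block-cong : ∀ e n {f g} → f ≈ g → ζ-block e n f ≈ ζ-block e n g
  ζ-block-cong e n f≈g = fold-cong (λ g → D (W g)) (λ h → D-cong (W-cong h)) n (fold-cong E E-cong e f≈g)

  ζ♭-block-cong : ∀ e n {f g} → f ≈ g → ζ♭-block e n f ≈ ζ♭-block e n g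
  ζ♭-block-cong e n f≈g = fold-cong D D-cong e (fold-cong (λ g → W (E g)) (λ h → W-cong (E-cong h)) n f≈g)

  𝟙-≤-step : ∀ j t w d z h →
    𝟙 ((suc j ≤ᵇ suc t) ∧ w) * ((d * z) * h) ≡ 𝟙 (j ≤ᵇ t) * (d * (𝟙 w * (z * h)))
  𝟙-≤-step j t w d z h = begin
    𝟙 ((suc j ≤ᵇ suc t) ∧ w) * ((d * z) * h) ≡⟨ cong (λ a → 𝟙 (a ∧ w) * ((d * z) * h)) (m<ᵇ1+n≡m≤ᵇn j t) ⟩
    𝟙 ((j ≤ᵇ t) ∧ w) * ((d * z) * h)         ≡⟨ cong (_* ((d * z) * h)) (𝟙-∧ (j ≤ᵇ t) w) ⟩
    (𝟙 (j ≤ᵇ t) * 𝟙 w) * ((d * z) * h)       ≡⟨ reorder (𝟙 (j ≤ᵇ t)) (𝟙 w) d z h ⟩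
    𝟙 (j ≤ᵇ t) * (d * (𝟙 w * (z * h)))       ∎
    where
    open ≡-Reasoning
    reorder : ∀ a b d z h → (a * b) * ((d * z) * h) ≡ a * (d * (b * (z * h)))
    reorder = solve 5 (λ a b d z h → (a :* b) :* ((d :* z) :* h) := a :* (d :* (b :* (z :* h)))) refl

  block-sum-ζ : ∀ e n (H : ℕ → ℚ) j →
    sumℚ (map (λ b → 𝟙 (weakInc (suc j ∷ b)) * (zBlock N e (suc j ∷ b) * H (lastFrom (suc j) b))) (tuples N n))
      ≡ ζ-block e n (λ u → H (suc u)) j
  block-sum-ζ e zero    H j = trans (+-identityʳ _)
    (trans (*-identityˡ _) (sym (fold-scale suc (λ u → H (suc u)) e j)))
  block-sum-ζ e (suc n) H j = begin
    sumℚ (map (F j) (tuples N (suc n)))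
      ≡⟨ sumℚ-tuples-suc M n (F j) ⟩
    σ (λ t → sumℚ (map (λ b → F j (suc t ∷ b)) (tuples N n))) M
      ≡⟨ σ-cong M (λ t _ → next t) ⟩
    σ (λ t → inv (M ∸ j) * (𝟙 (j ≤ᵇ t) * ζ-block e n G t)) M
      ≡⟨ *-distribˡ-σ (inv (M ∸ j)) (λ t → 𝟙 (j ≤ᵇ t) * ζ-block e n G t) M ⟨
    ζ-block e (suc n) G j ∎
    where
    open ≡-Reasoning
    G : Fn
    G u = H (suc u)
    F : ℕ → List ℕ → ℚ
    F j b = 𝟙 (weakInc (suc j ∷ b)) * (zBlock N e (suc j ∷ b) * H (lastFrom (suc j) b))
    next : ∀ t → sumℚ (map (λ b → F j (suc t ∷ b)) (tuples N n)) ≡ inv (M ∸ j) * (𝟙 (j ≤ᵇ t) * ζ-block e n G t)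
    next t = begin
      sumℚ (map (λ b → F j (suc t ∷ b)) (tuples N n))
        ≡⟨ sumℚ-map-cong (tuples N n) (λ b → trans (𝟙-≤-step j t _ (inv (M ∸ j)) (zBlock N e (suc t ∷ b)) _)
                                                   (x∙yz≈y∙xz (𝟙 (j ≤ᵇ t)) (inv (M ∸ j)) (F t b))) ⟩
      sumℚ (map (λ b → inv (M ∸ j) * (𝟙 (j ≤ᵇ t) * F t b)) (tuples N n))
        ≡⟨ *-distribˡ-sumℚ (inv (M ∸ j)) (λ b → 𝟙 (j ≤ᵇ t) * F t b) (tuples N n) ⟨
      inv (M ∸ j) * sumℚ (map (λ b → 𝟙 (j ≤ᵇ t) * F t b) (tuples N n))
        ≡⟨ cong (inv (M ∸ j) *_) (*-distribˡ-sumℚ (𝟙 (j ≤ᵇ t)) (F t) (tuples N n)) ⟨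
      inv (M ∸ j) * (𝟙 (j ≤ᵇ t) * sumℚ (map (F t) (tuples N n)))
        ≡⟨ cong (λ z → inv (M ∸ j) * (𝟙 (j ≤ᵇ t) * z)) (block-sum-ζ e n H t) ⟩
      inv (M ∸ j) * (𝟙 (j ≤ᵇ t) * ζ-block e n G t) ∎

  tail-sum-ζ♭ : ∀ n (H : ℕ → ℚ) j →
    sumℚ (map (λ b → 𝟙 (weakInc (suc j ∷ b)) * (prodℚ (map inv b) * H (lastFrom (suc j) b))) (tuples N n))
      ≡ fold (λ u → H (suc u)) (λ g → W (E g)) n j
  tail-sum-ζ♭ zero    H j = trans (+-identityʳ _) (trans (*-identityˡ _) (*-identityˡ (H (suc j))))
  tail-sum-ζ♭ (suc n) H j = begin
    sumℚ (map (F j) (tuples N (suc n)))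
      ≡⟨ sumℚ-tuples-suc M n (F j) ⟩
    σ (λ t → sumℚ (map (λ b → F j (suc t ∷ b)) (tuples N n))) M
      ≡⟨ σ-cong M (λ t _ → next t) ⟩
    W (E (fold G (λ g → W (E g)) n)) j ∎
    where
    open ≡-Reasoning
    G : Fn
    G u = H (suc u)
    F : ℕ → List ℕ → ℚ
    F j b = 𝟙 (weakInc (suc j ∷ b)) * (prodℚ (map inv b) * H (lastFrom (suc j) b))
    next : ∀ t → sumℚ (map (λ b → F j (suc t ∷ b)) (tuples N n)) ≡ 𝟙 (j ≤ᵇ t) * E (fold G (λ g → W (E g)) n) t
    next t = begin
      sumℚ (map (λ b → F j (suc t ∷ b)) (tuples N n))
        ≡⟨ sumℚ-map-cong (tuples N n) (λ b → 𝟙-≤-step j t _ (inv (suc t)) (prodℚ (map inv b)) _) ⟩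
      sumℚ (map (λ b → 𝟙 (j ≤ᵇ t) * (inv (suc t) * F t b)) (tuples N n))
        ≡⟨ *-distribˡ-sumℚ (𝟙 (j ≤ᵇ t)) (λ b → inv (suc t) * F t b) (tuples N n) ⟨
      𝟙 (j ≤ᵇ t) * sumℚ (map (λ b → inv (suc t) * F t b) (tuples N n))
        ≡⟨ cong (𝟙 (j ≤ᵇ t) *_) (*-distribˡ-sumℚ (inv (suc t)) (F t) (tuples N n)) ⟨
      𝟙 (j ≤ᵇ t) * (inv (suc t) * sumℚ (map (F t) (tuples N n)))
        ≡⟨ cong (λ z → 𝟙 (j ≤ᵇ t) * (inv (suc t) * z)) (tail-sum-ζ♭ n H t) ⟩
      𝟙 (j ≤ᵇ t) * E (fold G (λ g → W (E g)) n) t ∎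

  block-sum-ζ♭ : ∀ e n (H : ℕ → ℚ) j →
    sumℚ (map (λ b → 𝟙 (weakInc (suc j ∷ b)) * (fBlock N e (suc j ∷ b) * H (lastFrom (suc j) b))) (tuples N n))
      ≡ ζ♭-block e n (λ u → H (suc u)) j
  block-sum-ζ♭ e n H j = begin
    sumℚ (map (λ b → 𝟙 (weakInc (suc j ∷ b)) * ((d * prodℚ (map inv b)) * H (lastFrom (suc j) b))) (tuples N n))
      ≡⟨ sumℚ-map-cong (tuples N n) (λ b →
           reorder (𝟙 (weakInc (suc j ∷ b))) d (prodℚ (map inv b)) (H (lastFrom (suc j) b))) ⟩
    sumℚ (map (λ b → d * F b) (tuples N n))
      ≡⟨ *-distribˡ-sumℚ d F (tuples N n) ⟨
    d * sumℚ (map F (tuples N n))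
      ≡⟨ cong (d *_) (tail-sum-ζ♭ n H j) ⟩
    d * fold (λ u → H (suc u)) (λ g → W (E g)) n j
      ≡⟨ fold-scale (M ∸_) (fold (λ u → H (suc u)) (λ g → W (E g)) n) e j ⟨
    ζ♭-block e n (λ u → H (suc u)) j ∎
    where
    open ≡-Reasoning
    d = inv ((M ∸ j) ^ e)
    F : List ℕ → ℚ
    F b = 𝟙 (weakInc (suc j ∷ b)) * (prodℚ (map inv b) * H (lastFrom (suc j) b))
    reorder : ∀ a d z h → a * ((d * z) * h) ≡ d * (a * (z * h))
    reorder = solve 4 (λ a d z h → a :* ((d :* z) :* h) := d :* (a :* (z :* h))) refl

  module ζSums  = BlockSums (zBlock N) (zWeight N) refl (λ _ _ _ _ → refl) ζ-block block-sum-ζ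
  module ζ♭Sums = BlockSums (fBlock N) (fWeight N) refl (λ _ _ _ _ → refl) ζ♭-block block-sum-ζ♭

  blockWord : ℕ → ℕ → List Letter → List Letter
  blockWord x y w = replicate x L ++ K ∷ replicate y K ++ w

  word : ∀ {xs ys} → IndexPair xs ys → List Letter
  word []           = []
  word (cons x y i) = L ∷ blockWord x y (word i)

  ζ-word-Ks : ∀ y w → ζ-word K (replicate y K ++ w) ≈ fold (ζ-word K w) E y
  ζ-word-Ks zero    w = λ _ _ → refl
  ζ-word-Ks (suc y) w = E-cong (ζ-word-Ks y w)

  ζ♭-word-Ks : ∀ y w → ζ♭-word K (replicate y K ++ w) ≈ fold (ζ♭-word K w) (λ g → W (E g)) y
  ζ♭-word-Ks zero    w = λ _ _ → refl
  ζ♭-word-Ks (suc y) w = W-cong (E-cong (ζ♭-word-Ks y w))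

  ζ-word-block : ∀ x y w → ζ-word L (blockWord x y w) ≈ ζ-block (suc y) x (ζ-word K w)
  ζ-word-block zero    y w = E-cong (ζ-word-Ks y w)
  ζ-word-block (suc x) y w = D-cong (W-cong (ζ-word-block x y w))

  ζ♭-word-block : ∀ x y w → ζ♭-word L (blockWord x y w) ≈ ζ♭-block (suc x) y (ζ♭-word K w)
  ζ♭-word-block zero    y w = D-cong (ζ♭-word-Ks y w)
  ζ♭-word-block (suc x) y w = D-cong (ζ♭-word-block x y w)

  ζ-word≈nested-sum : ∀ {xs ys} (i : IndexPair xs ys) →
                      ζ-word K (word i) ≈ (λ u → ζSums.nested-sum i (suc u <ᵇ_))
  ζ-word≈nested-sum []           = λ _ _ → refl
  ζ-word≈nested-sum (cons x y i) = S-cong (λ j j<M →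
    trans (ζ-word-block x y (word i) j j<M) (ζ-block-cong (suc y) x (ζ-word≈nested-sum i) j j<M))

  ζ♭-word≈nested-sum : ∀ {xs ys} (i : IndexPair xs ys) →
                       ζ♭-word K (word i) ≈ (λ u → ζ♭Sums.nested-sum (swap i) (suc u <ᵇ_))
  ζ♭-word≈nested-sum []           = λ _ _ → refl
  ζ♭-word≈nested-sum (cons x y i) = S-cong (λ j j<M →
    trans (ζ♭-word-block x y (word i) j j<M) (ζ♭-block-cong (suc x) y (ζ♭-word≈nested-sum i) j j<M))

  ++-ends : ∀ {b c} xs {w} → EndsInK c w → EndsInK b (xs ++ c ∷ w)
  ++-ends []       e = _∷_ e
  ++-ends (x ∷ xs) e = _∷_ (++-ends xs e)

  blockWord-ends : ∀ x y {xs ys} (i : IndexPair xs ys) → EndsInK L (blockWord x y (word i))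
  Ks-ends : ∀ y {xs ys} (i : IndexPair xs ys) → EndsInK K (replicate y K ++ word i)
  blockWord-ends x y i = ++-ends (replicate x L) (Ks-ends y i)
  Ks-ends zero    []             = end
  Ks-ends (suc y) []             = _∷_ (Ks-ends y [])
  Ks-ends y       (cons x′ y′ i) = ++-ends (replicate y K) (blockWord-ends x′ y′ i)

  zetaN≡σ-ζ-word : ∀ x y {xs ys} (i : IndexPair xs ys) →
    zetaN N (suc x ∷ xs) (suc y ∷ ys) ≡ σ (ζ-word L (blockWord x y (word i))) M
  zetaN≡σ-ζ-word x y i = trans (ζSums.sum-admissible (cons x y i)) (σ-cong M (λ j j<M →
    trans (*-identityˡ _) (sym (trans (ζ-word-block x y (word i) j j<M)
                                      (ζ-block-cong (suc y) x (ζ-word≈nested-sum i) j j<M)))))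

  zetaFlatN≡σ-ζ♭-word : ∀ x y {xs ys} (i : IndexPair xs ys) →
    zetaFlatN N (suc x ∷ xs) (suc y ∷ ys) ≡ σ (ζ♭-word L (blockWord x y (word i))) M
  zetaFlatN≡σ-ζ♭-word x y i = trans (ζ♭Sums.sum-admissible (cons y x (swap i))) (σ-cong M (λ j j<M →
    trans (*-identityˡ _) (sym (trans (ζ♭-word-block x y (word i) j j<M)
                                      (ζ♭-block-cong (suc x) y (ζ♭-word≈nested-sum i) j j<M)))))

  duality : ∀ {xs ys} → IndexPair xs ys → zetaN N xs ys ≡ zetaFlatN N xs ys
  duality []           = refl
  duality (cons x y i) = trans (zetaN≡σ-ζ-word x y i)
    (trans (word-duality (blockWord-ends x y i)) (sym (zetaFlatN≡σ-ζ♭-word x y i)))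

toIndexPair : ∀ {r} (k l : Vec ℕ r) → All (1 ≤_) k → All (1 ≤_) l → IndexPair (toList l) (toList k)
toIndexPair []          []          []             []             = []
toIndexPair (suc y ∷ k) (suc x ∷ l) (s≤s z≤n ∷ k⁺) (s≤s z≤n ∷ l⁺) = cons x y (toIndexPair k l k⁺ l⁺)

theorem3p7 : (N : ℕ) → 1 ≤ N → (r : ℕ) → (k l : Vec ℕ r) →
    All (1 ≤_) k → All (1 ≤_) l →
    zetaN N (toList l) (toList k) ≡ zetaFlatN N (toList l) (toList k)
theorem3p7 (suc M) _ r k l k⁺ l⁺ = Bridge.duality M (toIndexPair k l k⁺ l⁺)
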